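{- Let $(G,\cdot)$ be a finite cyclic group of order $N$, let $g \in G$ be a generator, and let $A = \mathbb{Z}/N\mathbb{Z}$. For $h \in G$ let $\log_g h \in A$ denote the unique class $x$ with $g^x = h$. Let $F \subseteq G$ be a finite subset with $\langle F \rangle = G$, and consider the surjective group homomorphism \[ \phi \colon A^F \to G, \quad (e_f)_{f \in F} \mapsto \prod_{f \in F} f^{e_f}. \] Let $R \subseteq \ker \phi$ be a subset such that $\operatorname{span} R = \ker \phi$ (the span taken as $A$-submodule of $A^F$), and let $(x_f)_{f \in F} \in R^{\perp}$, i.e., $\sum_{f \in F} x_f e_f = 0$ in $A$ for all $(e_f)_{f\in F} \in R$. Then there exists $\lambda \in A$ such that $x_f = \lambda \log_g f$ for all $f \in F$.
   Context: $A^F$ denotes the free $A$-module of tuples indexed by $F$. For a subset $S \subseteq A^F$, $S^{\perp} = \{ (x_f)_{f\in F} \in A^F : \sum_{f\in F} x_f e_f = 0 \text{ for all } (e_f)_{f\in F} \in S\}$. -}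

module Defs where

open import Level using (Level; _⊔_; Lift)
open import Algebra.Bundles using (Group)
open import Data.Nat using (ℕ; zero; suc; _+_; _*_)
open import Data.Fin using (Fin)
import Data.Fin as Fin
open import Data.Product using (∃; ∃-syntax; _×_; _,_)
open import Function.Bundles using (Inverse)
open import Relation.Binary.PropositionalEquality using (_≡_)
import Relation.Binary.PropositionalEquality as ≡

-- Congruence modulo N on ℕ.  Elements of A = ℤ/Nℤ are represented by
-- natural-number representatives; equality in A is this relation.
_≡_[mod_] : ℕ → ℕ → ℕ → Set
a ≡ b [mod N ] = ∃[ k ] ∃[ l ] (a + k * N ≡ b + l * N)

sumF : ∀ {m} → (Fin m → ℕ) → ℕ
sumF {zero}  v = 0
sumF {suc m} v = v Fin.zero + sumF (λ i → v (Fin.suc i))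

module _ {c ℓ : Level} (G : Group c ℓ) where
  open Group G

  pow : Carrier → ℕ → Carrier
  pow x zero    = ε
  pow x (suc n) = x ∙ pow x n

  prodF : ∀ {m} → (Fin m → Carrier) → Carrier
  prodF {zero}  v = ε
  prodF {suc m} v = v Fin.zero ∙ prodF (λ i → v (Fin.suc i))

  -- φ : A^F → G,  (e_f) ↦ ∏ f^{e_f}, for F given as an indexing Fin m → G
  phi : ∀ {m} → (Fin m → Carrier) → (Fin m → ℕ) → Carrier
  phi F e = prodF (λ i → pow (F i) (e i))

  data Generated (P : Carrier → Set (c ⊔ ℓ)) : Carrier → Set (c ⊔ ℓ) where
    gen-base : ∀ {x} → P x → Generated P x
    gen-ε    : Generated P ε
    gen-∙    : ∀ {x y} → Generated P x → Generated P y → Generated P (x ∙ y)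
    gen-⁻¹   : ∀ {x} → Generated P x → Generated P (x ⁻¹)
    gen-≈    : ∀ {x y} → Generated P x → x ≈ y → Generated P y

  HasOrder : ℕ → Set (c ⊔ ℓ)
  HasOrder N = Inverse (≡.setoid (Fin N)) setoid

  GeneratedBy : Carrier → Set (c ⊔ ℓ)
  GeneratedBy g = ∀ h → Generated (λ x → Lift c (x ≈ g)) h

  GeneratedByFamily : ∀ {m} → (Fin m → Carrier) → Set (c ⊔ ℓ)
  GeneratedByFamily F = ∀ h → Generated (λ x → Lift c (∃[ i ] (x ≈ F i))) h

-- A-linear span (A = ℤ/N) of a subset R of A^F, with A^F represented by Fin m → ℕ
data Span (N : ℕ) {m : ℕ} {r : Level} (R : (Fin m → ℕ) → Set r) : (Fin m → ℕ) → Set r where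
  sp-zero : Span N R (λ _ → 0)
  sp-gen  : ∀ {u} → R u → Span N R u
  sp-add  : ∀ {u v} → Span N R u → Span N R v → Span N R (λ i → u i + v i)
  sp-smul : ∀ {u} (a : ℕ) → Span N R u → Span N R (λ i → a * u i)
  sp-resp : ∀ {u v} → Span N R u → (∀ i → u i ≡ v i [mod N ]) → Span N R v

{-# OPTIONS --safe #-}

-- Write each f ∈ F as g^{k_f}, so that φ(e) = g^{k·e}, and pick e₀ with φ(e₀) = g.  A form x
-- vanishing on R vanishes on span R ⊇ ker φ, hence is constant on the fibres of φ: if
-- φ u = φ v then u + d v and v + d v lie in ker φ, where g^{d+1} = 1 (entries are natural
-- numbers, so d v stands in for −v).  The unit vector at f and k_f e₀ both map to f, hence
-- x_f ≡ x·(k_f e₀) = k_f (x·e₀), i.e. λ = x·e₀.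
module Submission where

open import Defs
open import Level using (Level; _⊔_; Lift; lift; 0ℓ)
open import Algebra.Bundles using (Group)
open import Data.Nat using (ℕ; zero; suc; _+_; _*_; _∸_)
open import Data.Nat.Properties
  using (*-zeroʳ; *-identityʳ; *-comm; *-distribˡ-+; +-identityʳ; +-comm; +-suc; +-cancelʳ-≡; m∸n+n≡m; n<1+n;
         +-commutativeSemigroup; *-commutativeSemigroup)
open import Algebra.Properties.CommutativeSemigroup +-commutativeSemigroup
  using () renaming (interchange to +-interchange)
open import Algebra.Properties.CommutativeSemigroup *-commutativeSemigroup
  using () renaming (x∙yz≈y∙xz to *-exchange)
open import Data.Nat.Tactic.RingSolver using (solve-∀)
open import Data.Fin using (Fin; toℕ) renaming (zero to fzero; suc to fsuc)
open import Data.Fin.Properties using (pigeonhole)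
open import Data.Product using (∃-syntax; _,_; proj₁; proj₂)
open import Function.Base using (_∘_)
open import Function.Bundles using (Inverse; Injection)
open import Function.Properties.Inverse using (Inverse⇒Injection)
import Function.Construct.Symmetry as Symmetry
open import Relation.Binary.Bundles using (Setoid)
open import Relation.Binary.PropositionalEquality as ≡ using (_≡_)
import Relation.Binary.Reasoning.Setoid as SetoidReasoning

module _ {N : ℕ} where

  mod-refl : ∀ {a} → a ≡ a [mod N ]
  mod-refl = 0 , 0 , ≡.refl

  mod-reflexive : ∀ {a b} → a ≡ b → a ≡ b [mod N ]
  mod-reflexive ≡.refl = mod-refl

  mod-sym : ∀ {a b} → a ≡ b [mod N ] → b ≡ a [mod N ]
  mod-sym (k , l , p) = l , k , ≡.sym p

  mod-trans : ∀ {a b c} → a ≡ b [mod N ] → b ≡ c [mod N ] → a ≡ c [mod N ]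
  mod-trans {a} {b} {c} (k , l , p) (k′ , l′ , q) = k + k′ , l′ + l , (begin
    a + (k + k′) * N       ≡⟨ shift a k k′ N ⟩
    (a + k * N) + k′ * N   ≡⟨ ≡.cong (_+ k′ * N) p ⟩
    (b + l * N) + k′ * N   ≡⟨ swap b l k′ N ⟩
    (b + k′ * N) + l * N   ≡⟨ ≡.cong (_+ l * N) q ⟩
    (c + l′ * N) + l * N   ≡⟨ shift c l′ l N ⟨
    c + (l′ + l) * N       ∎)
    where
      open ≡.≡-Reasoning
      shift : ∀ a k k′ N → a + (k + k′) * N ≡ (a + k * N) + k′ * N
      shift = solve-∀
      swap : ∀ b l k′ N → (b + l * N) + k′ * N ≡ (b + k′ * N) + l * N
      swap = solve-∀

  +-cong-mod : ∀ {a b a′ b′} → a ≡ b [mod N ] → a′ ≡ b′ [mod N ] → (a + a′) ≡ (b + b′) [mod N ]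
  +-cong-mod {a} {b} {a′} {b′} (k , l , p) (k′ , l′ , q) = k + k′ , l + l′ ,
    ≡.trans (regroup a a′ k k′ N) (≡.trans (≡.cong₂ _+_ p q) (≡.sym (regroup b b′ l l′ N)))
    where
      regroup : ∀ a a′ k k′ N → (a + a′) + (k + k′) * N ≡ (a + k * N) + (a′ + k′ * N)
      regroup = solve-∀

  *-congˡ-mod : ∀ c {a b} → a ≡ b [mod N ] → (c * a) ≡ (c * b) [mod N ]
  *-congˡ-mod c {a} {b} (k , l , p) = c * k , c * l ,
    ≡.trans (factor c a k N) (≡.trans (≡.cong (c *_) p) (≡.sym (factor c b l N)))
    where
      factor : ∀ c a k N → c * a + (c * k) * N ≡ c * (a + k * N)
      factor = solve-∀

modSetoid : ℕ → Setoid 0ℓ 0ℓ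
modSetoid N = record
  { Carrier = ℕ
  ; _≈_ = _≡_[mod N ]
  ; isEquivalence = record { refl = mod-refl ; sym = mod-sym ; trans = mod-trans }
  }

+-cancelʳ-mod : ∀ {N} q {p r} → (p + q) ≡ (r + q) [mod N ] → p ≡ r [mod N ]
+-cancelʳ-mod {N} q {p} {r} (k , l , eq) = k , l ,
  +-cancelʳ-≡ q (p + k * N) (r + l * N) (≡.trans (move p k q N) (≡.trans eq (≡.sym (move r l q N))))
  where
    move : ∀ a k q N → (a + k * N) + q ≡ (a + q) + k * N
    move = solve-∀

module _ {m : ℕ} where

  infixl 6 _⊕_
  infixr 7 _⊛_
  infix 8 _·_

  _⊕_ : (Fin m → ℕ) → (Fin m → ℕ) → Fin m → ℕ
  (u ⊕ v) i = u i + v i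

  _⊛_ : ℕ → (Fin m → ℕ) → Fin m → ℕ
  (a ⊛ u) i = a * u i

  _·_ : (Fin m → ℕ) → (Fin m → ℕ) → ℕ
  x · e = sumF (λ i → x i * e i)

unit : ∀ {m} → Fin m → Fin m → ℕ
unit fzero    fzero    = 1
unit fzero    (fsuc j) = 0
unit (fsuc i) fzero    = 0
unit (fsuc i) (fsuc j) = unit i j

module _ where
  open ≡.≡-Reasoning

  sumF-cong : ∀ {m} {u v : Fin m → ℕ} → (∀ i → u i ≡ v i) → sumF u ≡ sumF v
  sumF-cong {zero}  u≗v = ≡.refl
  sumF-cong {suc m} u≗v = ≡.cong₂ _+_ (u≗v fzero) (sumF-cong (λ i → u≗v (fsuc i)))

  sumF-cong-mod : ∀ {N m} {u v : Fin m → ℕ} →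
                  (∀ i → u i ≡ v i [mod N ]) → sumF u ≡ sumF v [mod N ]
  sumF-cong-mod {m = zero}  u≈v = mod-refl
  sumF-cong-mod {m = suc m} u≈v = +-cong-mod (u≈v fzero) (sumF-cong-mod (λ i → u≈v (fsuc i)))

  sumF-zero : ∀ m → sumF {m} (λ _ → 0) ≡ 0
  sumF-zero zero    = ≡.refl
  sumF-zero (suc m) = sumF-zero m

  sumF-⊕ : ∀ {m} (u v : Fin m → ℕ) → sumF (u ⊕ v) ≡ sumF u + sumF v
  sumF-⊕ {zero}  u v = ≡.refl
  sumF-⊕ {suc m} u v = ≡.trans (≡.cong (u fzero + v fzero +_) (sumF-⊕ (u ∘ fsuc) (v ∘ fsuc)))
                               (+-interchange (u fzero) (v fzero) _ _)

  sumF-⊛ : ∀ {m} a (u : Fin m → ℕ) → sumF (a ⊛ u) ≡ a * sumF u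
  sumF-⊛ {zero}  a u = ≡.sym (*-zeroʳ a)
  sumF-⊛ {suc m} a u = ≡.trans (≡.cong (a * u fzero +_) (sumF-⊛ a (u ∘ fsuc)))
                               (≡.sym (*-distribˡ-+ a (u fzero) _))

  ·-zeroʳ : ∀ {m} (x : Fin m → ℕ) → x · (λ _ → 0) ≡ 0
  ·-zeroʳ {m} x = ≡.trans (sumF-cong (λ i → *-zeroʳ (x i))) (sumF-zero m)

  ·-distribˡ-⊕ : ∀ {m} (x u v : Fin m → ℕ) → x · (u ⊕ v) ≡ x · u + x · v
  ·-distribˡ-⊕ x u v = ≡.trans (sumF-cong (λ i → *-distribˡ-+ (x i) (u i) (v i)))
                               (sumF-⊕ (λ i → x i * u i) (λ i → x i * v i))

  ·-⊛ : ∀ {m} (x : Fin m → ℕ) a u → x · (a ⊛ u) ≡ a * (x · u)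
  ·-⊛ x a u = ≡.trans (sumF-cong (λ i → *-exchange (x i) a (u i))) (sumF-⊛ a (λ i → x i * u i))

  ·-congʳ-mod : ∀ {N m} (x : Fin m → ℕ) {u v} →
                (∀ i → u i ≡ v i [mod N ]) → (x · u) ≡ (x · v) [mod N ]
  ·-congʳ-mod x u≈v = sumF-cong-mod (λ i → *-congˡ-mod (x i) (u≈v i))

  ·-unitʳ : ∀ {m} (x : Fin m → ℕ) i → x · unit i ≡ x i
  ·-unitʳ {suc m} x fzero = begin
    x fzero * 1 + x′ · (λ _ → 0)  ≡⟨ ≡.cong₂ _+_ (*-identityʳ _) (·-zeroʳ x′) ⟩
    x fzero + 0                   ≡⟨ +-identityʳ _ ⟩
    x fzero                       ∎
    where
      x′ : Fin m → ℕ
      x′ j = x (fsuc j)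
  ·-unitʳ {suc m} x (fsuc i) = ≡.cong₂ _+_ (*-zeroʳ (x fzero)) (·-unitʳ (λ j → x (fsuc j)) i)

orthogonal-Span : ∀ {N m r} {R : (Fin m → ℕ) → Set r} (x : Fin m → ℕ) →
                  (∀ e → R e → (x · e) ≡ 0 [mod N ]) →
                  ∀ {e} → Span N R e → (x · e) ≡ 0 [mod N ]
orthogonal-Span x x⊥R sp-zero         = mod-reflexive (·-zeroʳ x)
orthogonal-Span x x⊥R (sp-gen e∈R)    = x⊥R _ e∈R
orthogonal-Span x x⊥R (sp-add {u} {v} u∈ v∈) =
  mod-trans (mod-reflexive (·-distribˡ-⊕ x u v))
            (+-cong-mod (orthogonal-Span x x⊥R u∈) (orthogonal-Span x x⊥R v∈))
orthogonal-Span x x⊥R (sp-smul {u} a u∈) =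
  mod-trans (mod-reflexive (·-⊛ x a u))
            (mod-trans (*-congˡ-mod a (orthogonal-Span x x⊥R u∈)) (mod-reflexive (*-zeroʳ a)))
orthogonal-Span x x⊥R (sp-resp u∈ u≈v) =
  mod-trans (mod-sym (·-congʳ-mod x u≈v)) (orthogonal-Span x x⊥R u∈)

module _ {c ℓ : Level} (G : Group c ℓ) where
  open Group G
  open import Algebra.Properties.Monoid.Mult monoid using (_×_; ×-congʳ; ×-homo-+; ×-assocˡ)
  open import Algebra.Properties.Monoid.Sum monoid using (sum-replicate; sum-replicate-zero)
  open import Algebra.Properties.Group G using (inverseˡ-unique; identityˡ-unique)

  pow≡× : ∀ x n → pow G x n ≡ n × x
  pow≡× x zero    = ≡.refl
  pow≡× x (suc n) = ≡.cong (x ∙_) (pow≡× x n)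

  pow-+ : ∀ x m n → pow G x (m + n) ≈ pow G x m ∙ pow G x n
  pow-+ x m n rewrite pow≡× x (m + n) | pow≡× x m | pow≡× x n = ×-homo-+ x m n

  pow-* : ∀ x m n → pow G x (m * n) ≈ pow G (pow G x n) m
  pow-* x m n rewrite pow≡× x (m * n) | pow≡× (pow G x n) m | pow≡× x n = sym (×-assocˡ x m n)

  pow-congˡ : ∀ {x y} n → x ≈ y → pow G x n ≈ pow G y n
  pow-congˡ {x} {y} n x≈y rewrite pow≡× x n | pow≡× y n = ×-congʳ n x≈y

  pow-congʳ : ∀ x {m n} → m ≡ n → pow G x m ≈ pow G x n
  pow-congʳ x ≡.refl = refl

  pow-ε : ∀ n → pow G ε n ≈ ε
  pow-ε n rewrite pow≡× ε n = trans (sym (sum-replicate n)) (sum-replicate-zero n)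

  prodF-cong : ∀ {m} {u v : Fin m → Carrier} → (∀ i → u i ≈ v i) → prodF G u ≈ prodF G v
  prodF-cong {zero}  u≈v = refl
  prodF-cong {suc m} u≈v = ∙-cong (u≈v fzero) (prodF-cong (λ i → u≈v (fsuc i)))

  prodF-pow : ∀ {m} x (a : Fin m → ℕ) → prodF G (λ i → pow G x (a i)) ≈ pow G x (sumF a)
  prodF-pow {zero}  x a = refl
  prodF-pow {suc m} x a = trans (∙-congˡ (prodF-pow x (a ∘ fsuc))) (sym (pow-+ x (a fzero) _))

  HasOrder⇒torsion : ∀ {N} → HasOrder G N → ∀ x → ∃[ d ] pow G x (suc d) ≈ ε
  HasOrder⇒torsion {N} ord x
    with i , j , i<j , xⁱ≡xʲ ← pigeonhole (n<1+n N) (λ j → Inverse.from ord (pow G x (toℕ j)))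
    = d , identityˡ-unique _ _ (begin
      pow G x (suc d) ∙ pow G x (toℕ i) ≈⟨ pow-+ x (suc d) (toℕ i) ⟨
      pow G x (suc d + toℕ i)           ≈⟨ pow-congʳ x (≡.trans (≡.sym (+-suc d _)) (m∸n+n≡m i<j)) ⟩
      pow G x (toℕ j)                   ≈⟨ from-injective xⁱ≡xʲ ⟨
      pow G x (toℕ i)                   ∎)
    where
      open SetoidReasoning setoid
      d : ℕ
      d = toℕ j ∸ suc (toℕ i)
      from-injective : ∀ {y z} → Inverse.from ord y ≡ Inverse.from ord z → y ≈ z
      from-injective = Injection.injective (Inverse⇒Injection (Symmetry.inverse ord))

  module Cyclic (g : Carrier) {d : ℕ} (gᵈ⁺¹≈ε : pow G g (suc d) ≈ ε) where

    pow-period : ∀ a → pow G g (suc d * a) ≈ ε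
    pow-period a = trans (pow-congʳ g (*-comm (suc d) a))
                         (trans (pow-* g a (suc d)) (trans (pow-congˡ a gᵈ⁺¹≈ε) (pow-ε a)))

    pow-inverse : ∀ {a h} → pow G g a ≈ h → pow G g (d * a) ≈ h ⁻¹
    pow-inverse {a} gᵃ≈h = inverseˡ-unique _ _
      (trans (∙-congˡ (sym gᵃ≈h)) (trans (sym (pow-+ g (d * a) a))
        (trans (pow-congʳ g (+-comm (d * a) a)) (pow-period a))))

    discrete-log : GeneratedBy G g → ∀ h → ∃[ a ] pow G g a ≈ h
    discrete-log gen h = log (gen h)
      where
        log : ∀ {h} → Generated G (λ x → Lift c (x ≈ g)) h → ∃[ a ] pow G g a ≈ h
        log (gen-base (lift h≈g)) = 1 , trans (identityʳ g) (sym h≈g)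
        log gen-ε                 = 0 , refl
        log (gen-∙ x y)           with a , gᵃ≈x ← log x | b , gᵇ≈y ← log y
                                  = a + b , trans (pow-+ g a b) (∙-cong gᵃ≈x gᵇ≈y)
        log (gen-⁻¹ x)            with a , gᵃ≈x ← log x = d * a , pow-inverse gᵃ≈x
        log (gen-≈ x x≈y)         with a , gᵃ≈x ← log x = a , trans gᵃ≈x x≈y

    module Family {m} (F : Fin m → Carrier) {k : Fin m → ℕ} (gᵏ≈F : ∀ i → pow G g (k i) ≈ F i) where

      phi≈pow-· : ∀ e → phi G F e ≈ pow G g (k · e)
      phi≈pow-· e = trans (prodF-cong gᵏ≈F-power) (prodF-pow g (λ i → k i * e i))
        where
          gᵏ≈F-power : ∀ i → pow G (F i) (e i) ≈ pow G g (k i * e i)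
          gᵏ≈F-power i = trans (pow-congˡ (e i) (sym (gᵏ≈F i)))
                               (trans (sym (pow-* g (e i) (k i))) (pow-congʳ g (*-comm (e i) (k i))))

      phi-zero : phi G F (λ _ → 0) ≈ ε
      phi-zero = trans (phi≈pow-· (λ _ → 0)) (pow-congʳ g (·-zeroʳ k))

      phi-unit : ∀ i → phi G F (unit i) ≈ F i
      phi-unit i = trans (phi≈pow-· (unit i)) (trans (pow-congʳ g (·-unitʳ k i)) (gᵏ≈F i))

      phi-⊕ : ∀ u v → phi G F (u ⊕ v) ≈ phi G F u ∙ phi G F v
      phi-⊕ u v = trans (phi≈pow-· (u ⊕ v)) (trans (pow-congʳ g (·-distribˡ-⊕ k u v))
                    (trans (pow-+ g (k · u) (k · v)) (∙-cong (sym (phi≈pow-· u)) (sym (phi≈pow-· v)))))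

      phi-⊛ : ∀ a u → phi G F (a ⊛ u) ≈ pow G (phi G F u) a
      phi-⊛ a u = trans (phi≈pow-· (a ⊛ u)) (trans (pow-congʳ g (·-⊛ k a u))
                    (trans (pow-* g a (k · u)) (pow-congˡ a (sym (phi≈pow-· u)))))

      phi-d⊛ : ∀ u → phi G F (d ⊛ u) ≈ phi G F u ⁻¹
      phi-d⊛ u = trans (phi≈pow-· (d ⊛ u)) (trans (pow-congʳ g (·-⊛ k d u))
                   (pow-inverse (sym (phi≈pow-· u))))

      phi-surjective : GeneratedByFamily G F → ∀ h → ∃[ e ] phi G F e ≈ h
      phi-surjective gen h = preimage (gen h)
        where
          preimage : ∀ {h} → Generated G (λ x → Lift c (∃[ i ] x ≈ F i)) h → ∃[ e ] phi G F e ≈ h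
          preimage (gen-base (lift (i , h≈Fi))) = unit i , trans (phi-unit i) (sym h≈Fi)
          preimage gen-ε                        = (λ _ → 0) , phi-zero
          preimage (gen-∙ x y) with u , φu≈x ← preimage x | v , φv≈y ← preimage y
                                                = u ⊕ v , trans (phi-⊕ u v) (∙-cong φu≈x φv≈y)
          preimage (gen-⁻¹ x) with u , φu≈x ← preimage x
                                                = d ⊛ u , trans (phi-d⊛ u) (⁻¹-cong φu≈x)
          preimage (gen-≈ x x≈y) with u , φu≈x ← preimage x
                                                = u , trans φu≈x x≈y

      phi-fibre : ∀ {u v} → phi G F u ≈ phi G F v → phi G F (u ⊕ d ⊛ v) ≈ ε
      phi-fibre {u} {v} φu≈φv =
        trans (phi-⊕ u (d ⊛ v)) (trans (∙-cong φu≈φv (phi-d⊛ v)) (inverseʳ (phi G F v)))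

      ·-constant-on-fibres : ∀ {N} x → (∀ e → phi G F e ≈ ε → (x · e) ≡ 0 [mod N ]) →
                             ∀ {u v} → phi G F u ≈ phi G F v → (x · u) ≡ (x · v) [mod N ]
      ·-constant-on-fibres {N} x x⊥ker {u} {v} φu≈φv =
        +-cancelʳ-mod (d * (x · v)) (mod-trans (vanishes φu≈φv) (mod-sym (vanishes refl)))
        where
          vanishes : ∀ {w} → phi G F w ≈ phi G F v → (x · w + d * (x · v)) ≡ 0 [mod N ]
          vanishes {w} φw≈φv = mod-trans
            (mod-reflexive (≡.sym (≡.trans (·-distribˡ-⊕ x w (d ⊛ v)) (≡.cong (x · w +_) (·-⊛ x d v)))))
            (x⊥ker (w ⊕ d ⊛ v) (phi-fibre {w} {v} φw≈φv))

lemma1 : {c ℓ : Level} (G : Group c ℓ) (N : ℕ) (g : Group.Carrier G) →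
    HasOrder G N → GeneratedBy G g →
    (m : ℕ) (F : Fin m → Group.Carrier G) →
    (∀ i j → Group._≈_ G (F i) (F j) → i ≡ j) →
    GeneratedByFamily G F →
    (R : (Fin m → ℕ) → Set (c ⊔ ℓ)) →
    (∀ e → R e → Group._≈_ G (phi G F e) (Group.ε G)) →
    (∀ e → Group._≈_ G (phi G F e) (Group.ε G) → Span N R e) →
    (x : Fin m → ℕ) →
    (∀ e → R e → sumF (λ i → x i * e i) ≡ 0 [mod N ]) →
    ∃[ λ′ ] (∀ i (k : ℕ) → Group._≈_ G (pow G g k) (F i) → x i ≡ λ′ * k [mod N ])
lemma1 G N g order genG m F _ genF _ _ ker⊆span x x⊥R = x · e₀ , x-proportional
  where
    open Group G
    open Cyclic G g {proj₁ (HasOrder⇒torsion G order g)} (proj₂ (HasOrder⇒torsion G order g))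
    open Family F {λ i → proj₁ (discrete-log genG (F i))} (λ i → proj₂ (discrete-log genG (F i)))

    e₀ : Fin m → ℕ
    e₀ = proj₁ (phi-surjective genF g)

    x⊥ker : ∀ e → phi G F e ≈ ε → (x · e) ≡ 0 [mod N ]
    x⊥ker e φe≈ε = orthogonal-Span x x⊥R (ker⊆span e φe≈ε)

    x-proportional : ∀ i a → pow G g a ≈ F i → x i ≡ (x · e₀) * a [mod N ]
    x-proportional i a gᵃ≈Fi = begin
      x i            ≡⟨ ·-unitʳ x i ⟨
      x · unit i     ≈⟨ ·-constant-on-fibres x x⊥ker (trans (phi-unit i) (sym φ[a⊛e₀]≈Fi)) ⟩
      x · (a ⊛ e₀)   ≡⟨ ·-⊛ x a e₀ ⟩
      a * (x · e₀)   ≡⟨ *-comm a (x · e₀) ⟩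
      (x · e₀) * a   ∎
      where
        open SetoidReasoning (modSetoid N)
        φ[a⊛e₀]≈Fi : phi G F (a ⊛ e₀) ≈ F i
        φ[a⊛e₀]≈Fi = trans (phi-⊛ a e₀) (trans (pow-congˡ G a (proj₂ (phi-surjective genF g))) gᵃ≈Fi)
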